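{- Let $G$ be a connected graph with $n\ge 3$ vertices. If $G$ has a cut edge, then $\Omega_G(u,v)>\frac{2}{n}$ for any two distinct vertices $u,v\in V(G)$.
   Context: All graphs are finite and simple. For a connected graph $G$, regard each edge as a unit resistor. $\Omega_G(u,v)$ is the effective resistance (resistance distance) between $u$ and $v$. A cut edge is an edge whose removal disconnects the graph. -}

module Defs where

open import Data.Nat using (ℕ; zero; suc)
open import Data.Bool using (Bool; true; false; if_then_else_; _∧_; not)
open import Data.Fin using (Fin; zero; suc; _≟_)
open import Data.Integer using (+_)
open import Data.Rational using (ℚ; 0ℚ; 1ℚ; _+_; _-_; -_; _/_)
open import Data.Product using (Σ; _×_; ∃)
open import Relation.Binary.PropositionalEquality using (_≡_; _≢_)
open import Relation.Nullary using (¬_; ⌊_⌋)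

record Graph (n : ℕ) : Set where
  field
    adj     : Fin n → Fin n → Bool
    symm    : ∀ i j → adj i j ≡ adj j i
    irrefl  : ∀ i → adj i i ≡ false
open Graph public

Adj : ∀ {n} → Graph n → Fin n → Fin n → Set
Adj G i j = adj G i j ≡ true

data Reach {n : ℕ} (G : Graph n) : Fin n → Fin n → Set where
  here : ∀ {u} → Reach G u u
  step : ∀ {u w v} → Adj G u w → Reach G w v → Reach G u v

Connected : ∀ {n} → Graph n → Set
Connected G = ∀ u v → Reach G u v

removeEdge : ∀ {n} → (G : Graph n) → Fin n → Fin n → Graph n
removeEdge {n} G a b = record
  { adj = adj'
  ; symm = sym'
  ; irrefl = irr' }
  where
    isab : Fin n → Fin n → Bool
    isab i j = (⌊ i ≟ a ⌋ ∧ ⌊ j ≟ b ⌋)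
    isAB : Fin n → Fin n → Bool
    isAB i j = if isab i j then true else isab j i
    adj' : Fin n → Fin n → Bool
    adj' i j = if isAB i j then false else adj G i j
    open import Relation.Binary.PropositionalEquality using (refl; cong₂)
    open import Data.Bool.Properties using (∨-comm)
    isAB-sym : ∀ i j → isAB i j ≡ isAB j i
    isAB-sym i j with isab i j | isab j i
    ... | true  | true  = refl
    ... | true  | false = refl
    ... | false | true  = refl
    ... | false | false = refl
    sym' : ∀ i j → adj' i j ≡ adj' j i
    sym' i j with isAB i j | isAB j i | isAB-sym i j
    ... | true  | .true  | refl = refl
    ... | false | .false | refl = Graph.symm G i j
    irr' : ∀ i → adj' i i ≡ false
    irr' i with isAB i i
    ... | true  = refl
    ... | false = Graph.irrefl G i

IsCutEdge : ∀ {n} → Graph n → Fin n → Fin n → Set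
IsCutEdge G a b = Adj G a b × ¬ Connected (removeEdge G a b)

HasCutEdge : ∀ {n} → Graph n → Set
HasCutEdge {n} G = Σ (Fin n) λ a → Σ (Fin n) λ b → IsCutEdge G a b

sumFin : ∀ n → (Fin n → ℚ) → ℚ
sumFin zero    f = 0ℚ
sumFin (suc n) f = f zero + sumFin n (λ i → f (suc i))

-- Laplacian L = D - A applied to a vector x: (L x)_i = Σ_{j ~ i} (x_i - x_j).
laplacian : ∀ {n} → Graph n → (Fin n → ℚ) → Fin n → ℚ
laplacian {n} G x i = sumFin n λ j → if adj G i j then x i - x j else 0ℚ

unitCurrent : ∀ {n} → Fin n → Fin n → Fin n → ℚ
unitCurrent u v i =
  (if ⌊ i ≟ u ⌋ then 1ℚ else 0ℚ) - (if ⌊ i ≟ v ⌋ then 1ℚ else 0ℚ)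

-- r is the effective resistance Ω_G(u,v) (unit resistors on every edge):
-- r = (e_u - e_v)ᵀ x for a potential x with L x = e_u - e_v, i.e.
-- r = x_u - x_v (equivalently (e_u - e_v)ᵀ L⁺ (e_u - e_v)).
IsEffRes : ∀ {n} → Graph n → Fin n → Fin n → ℚ → Set
IsEffRes {n} G u v r =
  Σ (Fin n → ℚ) λ x →
    (∀ i → laplacian G x i ≡ unitCurrent u v i) × (r ≡ x u - x v)

-- The rational 2/n (n ≥ 1; value at n = 0 is irrelevant).
twoOver : ℕ → ℚ
twoOver zero    = 0ℚ
twoOver (suc k) = (+ 2) / suc k

-- Write e = e_u − e_v and N = n.  Solving L x = e over ℚ can only fail if some y has yᵀL = 0 and
-- ⟨y, e⟩ ≠ 0 (Fredholm alternative, by Gaussian elimination); but then yᵀLy = 0, so y is constant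
-- along edges, hence constant on the connected graph and orthogonal to e.
-- For the bound, the form 2 zᵀLz = Σ_{i,j} a_ij (z_i − z_j)² is dominated termwise by the form
-- Σ_{i,j} (z_i − z_j)² of the complete graph, which equals 4N at z = e.  Expanding
-- 0 ≤ 2 (Nx − e)ᵀ L (Nx − e) with xᵀLx = Ω and eᵀLx = 2 gives 0 ≤ 2N²Ω − 8N + 2eᵀLe < 2N²Ω − 4N,
-- i.e. Ω > 2/N, as soon as the domination is strict at e: some non-adjacent i, j have e_i ≠ e_j.
-- Otherwise u and v are adjacent to each other and to all other vertices; with a third vertex
-- present, every edge then lies on a triangle, so G has no cut edge.
module Submission where

open import Defs
open import Data.Nat using (ℕ; _≤_)
open import Data.Fin using (Fin)
open import Data.Rational using (ℚ; _<_)
open import Data.Product using (Σ; _×_)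
open import Relation.Binary.PropositionalEquality using (_≢_)

open import Algebra.Bundles using (CommutativeRing)
open import Data.Bool using (true; false; if_then_else_)
import Data.Bool as Bool
open import Data.Bool.Properties using (¬-not)
open import Data.Empty using (⊥; ⊥-elim)
open import Data.Fin using (zero; suc; _≟_)
open import Data.Fin.Properties using (all?; ¬∀⟶∃¬)
import Data.Integer as ℤ
import Data.Integer.Properties as ℤ
open import Data.Nat using (zero; suc; s≤s)
import Data.Nat.Properties as ℕ
open import Data.Product using (_,_; ∃)
open import Data.Rational
  using (0ℚ; 1ℚ; _+_; _*_; _-_; -_; 1/_; NonZero; ≢-nonZero; nonNegative; positive; negative)
  renaming (_≤_ to _≤ℚ_)
open import Data.Rational.Literals using (fromℤ)
import Data.Rational.Properties as ℚ
open import Data.Vec.Functional using (_∷_)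
open import Data.Sum using (_⊎_; inj₁; inj₂)
open import Relation.Binary using (tri<; tri≈; tri>)
open import Relation.Binary.PropositionalEquality
  using (_≡_; refl; sym; trans; cong; cong₂; subst; subst₂; module ≡-Reasoning)
open import Relation.Nullary using (¬_; Dec; yes; no; ⌊_⌋)
open import Relation.Nullary.Decidable using (_⊎-dec_; dec⇒maybe)
open import Tactic.RingSolver using (solve-∀)
open import Tactic.RingSolver.Core.AlmostCommutativeRing
  using (AlmostCommutativeRing; fromCommutativeRing)

open import Algebra.Properties.Group ℚ.+-0-group using (x∙y⁻¹≈ε⇒x≈y)
open import Algebra.Properties.Ring ℚ.+-*-ring using (x[y-z]≈xy-xz)
open import Algebra.Properties.Semiring.Sum
  (CommutativeRing.semiring ℚ.+-*-commutativeRing)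
  using (sum-syntax; sum-cong-≗; ∑-distrib-+; ∑-comm; *-distribˡ-sum; *-distribʳ-sum)

ℚ-ring : AlmostCommutativeRing _ _
ℚ-ring = fromCommutativeRing ℚ.+-*-commutativeRing (λ x → dec⇒maybe (0ℚ ℚ.≟ x))

2ℚ : ℚ
2ℚ = 1ℚ + 1ℚ

fromℕ : ℕ → ℚ
fromℕ n = fromℤ (ℤ.+ n)

fromℕ-suc : ∀ n → 1ℚ + fromℕ n ≡ fromℕ (suc n)
fromℕ-suc n rewrite ℤ.*-identityʳ (ℤ.+ n) = ℚ.normalize-coprime _

square-pos : ∀ {p} → p ≢ 0ℚ → 0ℚ < p * p
square-pos {p} p≢0 with ℚ.<-cmp p 0ℚ
... | tri< p<0 _ _ = ℚ.positive⁻¹ (p * p) {{ℚ.neg*neg⇒pos p {{negative p<0}} p {{negative p<0}}}}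
... | tri≈ _ p≡0 _ = ⊥-elim (p≢0 p≡0)
... | tri> _ _ p>0 = ℚ.positive⁻¹ (p * p) {{ℚ.pos*pos⇒pos p {{positive p>0}} p {{positive p>0}}}}

square-nonNeg : ∀ p → 0ℚ ≤ℚ p * p
square-nonNeg p with p ℚ.≟ 0ℚ
... | yes refl = ℚ.≤-refl
... | no  p≢0  = ℚ.<⇒≤ (square-pos p≢0)

square≡0⇒≡0 : ∀ {p} → p * p ≡ 0ℚ → p ≡ 0ℚ
square≡0⇒≡0 {p} p²≡0 with p ℚ.≟ 0ℚ
... | yes p≡0 = p≡0
... | no  p≢0 = ⊥-elim (ℚ.<-irrefl (sym p²≡0) (square-pos p≢0))

sumFin≡∑ : ∀ n (f : Fin n → ℚ) → sumFin n f ≡ ∑[ i < n ] f i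
sumFin≡∑ zero    f = refl
sumFin≡∑ (suc n) f = cong (f zero +_) (sumFin≡∑ n (λ i → f (suc i)))

∑-neg : ∀ n (f : Fin n → ℚ) → ∑[ i < n ] (- f i) ≡ - ∑[ i < n ] f i
∑-neg zero    f = refl
∑-neg (suc n) f = begin
  - f zero + ∑[ i < n ] (- f (suc i))  ≡⟨ cong (- f zero +_) (∑-neg n (λ i → f (suc i))) ⟩
  - f zero + - ∑[ i < n ] f (suc i)    ≡⟨ ℚ.neg-distrib-+ (f zero) _ ⟨
  - (f zero + ∑[ i < n ] f (suc i))    ∎
  where open ≡-Reasoning

∑-distrib-- : ∀ n (f g : Fin n → ℚ) →
              ∑[ i < n ] (f i - g i) ≡ ∑[ i < n ] f i - ∑[ i < n ] g i
∑-distrib-- n f g =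
  trans (∑-distrib-+ f (λ i → - g i)) (cong (∑[ i < n ] f i +_) (∑-neg n g))

∑-linear : ∀ n α β (f g h : Fin n → ℚ) →
           ∑[ i < n ] (α * f i - β * g i + h i) ≡ α * ∑[ i < n ] f i - β * ∑[ i < n ] g i + ∑[ i < n ] h i
∑-linear n α β f g h = begin
  ∑[ i < n ] (α * f i - β * g i + h i)                   ≡⟨ ∑-distrib-+ (λ i → α * f i - β * g i) h ⟩
  ∑[ i < n ] (α * f i - β * g i) + ∑[ i < n ] h i         ≡⟨ cong (_+ ∑[ i < n ] h i) (∑-distrib-- n _ _) ⟩
  ∑[ i < n ] (α * f i) - ∑[ i < n ] (β * g i) + ∑[ i < n ] h i
    ≡⟨ cong (_+ ∑[ i < n ] h i) (cong₂ _-_ (*-distribˡ-sum α f) (*-distribˡ-sum β g)) ⟨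
  α * ∑[ i < n ] f i - β * ∑[ i < n ] g i + ∑[ i < n ] h i ∎
  where open ≡-Reasoning

∑-const : ∀ n c → ∑[ i < n ] c ≡ c * fromℕ n
∑-const zero    c = sym (ℚ.*-zeroʳ c)
∑-const (suc n) c = begin
  c + ∑[ i < n ] c    ≡⟨ cong (c +_) (∑-const n c) ⟩
  c + c * fromℕ n     ≡⟨ cong (_+ c * fromℕ n) (ℚ.*-identityʳ c) ⟨
  c * 1ℚ + c * fromℕ n ≡⟨ ℚ.*-distribˡ-+ c 1ℚ (fromℕ n) ⟨
  c * (1ℚ + fromℕ n)  ≡⟨ cong (c *_) (fromℕ-suc n) ⟩
  c * fromℕ (suc n)   ∎
  where open ≡-Reasoning

∑-mono-≤ : ∀ n {f g : Fin n → ℚ} → (∀ i → f i ≤ℚ g i) → ∑[ i < n ] f i ≤ℚ ∑[ i < n ] g i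
∑-mono-≤ zero    f≤g = ℚ.≤-refl
∑-mono-≤ (suc n) f≤g = ℚ.+-mono-≤ (f≤g zero) (∑-mono-≤ n (λ i → f≤g (suc i)))

∑-mono-< : ∀ n {f g : Fin n → ℚ} → (∀ i → f i ≤ℚ g i) → ∀ k → f k < g k →
           ∑[ i < n ] f i < ∑[ i < n ] g i
∑-mono-< (suc n) f≤g zero    fk<gk = ℚ.+-mono-<-≤ fk<gk (∑-mono-≤ n (λ i → f≤g (suc i)))
∑-mono-< (suc n) f≤g (suc k) fk<gk = ℚ.+-mono-≤-< (f≤g zero) (∑-mono-< n (λ i → f≤g (suc i)) k fk<gk)

∑-nonNeg : ∀ n {f : Fin n → ℚ} → (∀ i → 0ℚ ≤ℚ f i) → 0ℚ ≤ℚ ∑[ i < n ] f i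
∑-nonNeg zero    0≤f = ℚ.≤-refl
∑-nonNeg (suc n) 0≤f = ℚ.+-mono-≤ (0≤f zero) (∑-nonNeg n (λ i → 0≤f (suc i)))

nonNeg+nonNeg≡0⇒≡0 : ∀ {p q} → 0ℚ ≤ℚ p → 0ℚ ≤ℚ q → p + q ≡ 0ℚ → p ≡ 0ℚ
nonNeg+nonNeg≡0⇒≡0 {p} {q} 0≤p 0≤q p+q≡0 = ℚ.≤-antisym p≤0 0≤p
  where
  p≤0 : p ≤ℚ 0ℚ
  p≤0 = subst₂ _≤ℚ_ (ℚ.+-identityʳ p) p+q≡0 (ℚ.+-monoʳ-≤ p 0≤q)

∑-nonNeg-≡0 : ∀ n {f : Fin n → ℚ} → (∀ i → 0ℚ ≤ℚ f i) → ∑[ i < n ] f i ≡ 0ℚ → ∀ i → f i ≡ 0ℚ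
∑-nonNeg-≡0 (suc n) {f} 0≤f ∑≡0 = λ
  { zero    → nonNeg+nonNeg≡0⇒≡0 (0≤f zero) 0≤rest ∑≡0
  ; (suc i) → ∑-nonNeg-≡0 n (λ i → 0≤f (suc i)) rest≡0 i }
  where
  rest : ℚ
  rest = ∑[ i < n ] f (suc i)
  0≤rest : 0ℚ ≤ℚ rest
  0≤rest = ∑-nonNeg n (λ i → 0≤f (suc i))
  rest≡0 : rest ≡ 0ℚ
  rest≡0 = nonNeg+nonNeg≡0⇒≡0 0≤rest (0≤f zero) (trans (ℚ.+-comm rest (f zero)) ∑≡0)

⟨_,_⟩ : ∀ {n} → (Fin n → ℚ) → (Fin n → ℚ) → ℚ
⟨_,_⟩ {n} f g = ∑[ i < n ] (f i * g i)

-- With this δ, unitCurrent u v i is δ u i - δ v i by definition.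
δ : ∀ {n} → Fin n → Fin n → ℚ
δ u i = if ⌊ i ≟ u ⌋ then 1ℚ else 0ℚ

δ-suc : ∀ {n} (u i : Fin n) → δ (suc u) (suc i) ≡ δ u i
δ-suc u i with i ≟ u
... | yes _ = refl
... | no  _ = refl

∑-*0 : ∀ n (f : Fin n → ℚ) → ∑[ i < n ] (f i * 0ℚ) ≡ 0ℚ
∑-*0 n f = trans (sym (*-distribʳ-sum 0ℚ f)) (ℚ.*-zeroʳ (∑[ i < n ] f i))

⟨-,δ⟩ : ∀ {n} (f : Fin n → ℚ) u → ⟨ f , δ u ⟩ ≡ f u
⟨-,δ⟩ {suc n} f zero = begin
  f zero * 1ℚ + ∑[ i < n ] (f (suc i) * 0ℚ) ≡⟨ cong₂ _+_ (ℚ.*-identityʳ (f zero)) (∑-*0 n (λ i → f (suc i))) ⟩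
  f zero + 0ℚ                              ≡⟨ ℚ.+-identityʳ (f zero) ⟩
  f zero                                   ∎
  where open ≡-Reasoning
⟨-,δ⟩ {suc n} f (suc u) = begin
  f zero * 0ℚ + ∑[ i < n ] (f (suc i) * δ (suc u) (suc i))
    ≡⟨ cong₂ _+_ (ℚ.*-zeroʳ (f zero)) (sum-cong-≗ (λ i → cong (f (suc i) *_) (δ-suc u i))) ⟩
  0ℚ + ⟨ (λ i → f (suc i)) , δ u ⟩
    ≡⟨ trans (ℚ.+-identityˡ _) (⟨-,δ⟩ (λ i → f (suc i)) u) ⟩
  f (suc u) ∎
  where open ≡-Reasoning

⟨-,-⟩-comm : ∀ {n} (f g : Fin n → ℚ) → ⟨ f , g ⟩ ≡ ⟨ g , f ⟩
⟨-,-⟩-comm f g = sum-cong-≗ (λ i → ℚ.*-comm (f i) (g i))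

⟨δ,-⟩ : ∀ {n} u (f : Fin n → ℚ) → ⟨ δ u , f ⟩ ≡ f u
⟨δ,-⟩ u f = trans (⟨-,-⟩-comm (δ u) f) (⟨-,δ⟩ f u)

⟨-,0⟩ : ∀ {n} (f : Fin n → ℚ) → ⟨ f , (λ _ → 0ℚ) ⟩ ≡ 0ℚ
⟨-,0⟩ {n} f = ∑-*0 n f

⟨-,-⟩-sub-scaledˡ : ∀ {n} (f h g : Fin n → ℚ) a →
                    ⟨ (λ i → f i - a * h i) , g ⟩ ≡ ⟨ f , g ⟩ - a * ⟨ h , g ⟩
⟨-,-⟩-sub-scaledˡ {n} f h g a = begin
  ∑[ i < n ] ((f i - a * h i) * g i)        ≡⟨ sum-cong-≗ (λ i → pointwise (f i) (h i) (g i) a) ⟩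
  ∑[ i < n ] (f i * g i - a * (h i * g i))  ≡⟨ ∑-distrib-- n _ _ ⟩
  ⟨ f , g ⟩ - ∑[ i < n ] (a * (h i * g i))  ≡⟨ cong (_-_ ⟨ f , g ⟩) (*-distribˡ-sum a (λ i → h i * g i)) ⟨
  ⟨ f , g ⟩ - a * ⟨ h , g ⟩                 ∎
  where
  open ≡-Reasoning
  pointwise : ∀ f h g a → (f - a * h) * g ≡ f * g - a * (h * g)
  pointwise = solve-∀ ℚ-ring

⟨-,-⟩-sub-scaledʳ : ∀ {n} (f g h : Fin n → ℚ) a →
                    ⟨ f , (λ i → g i - h i * a) ⟩ ≡ ⟨ f , g ⟩ - ⟨ f , h ⟩ * a
⟨-,-⟩-sub-scaledʳ {n} f g h a = begin
  ∑[ i < n ] (f i * (g i - h i * a))        ≡⟨ sum-cong-≗ (λ i → pointwise (f i) (g i) (h i) a) ⟩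
  ∑[ i < n ] (f i * g i - f i * h i * a)    ≡⟨ ∑-distrib-- n _ _ ⟩
  ⟨ f , g ⟩ - ∑[ i < n ] (f i * h i * a)    ≡⟨ cong (_-_ ⟨ f , g ⟩) (*-distribʳ-sum a (λ i → f i * h i)) ⟨
  ⟨ f , g ⟩ - ⟨ f , h ⟩ * a                 ∎
  where
  open ≡-Reasoning
  pointwise : ∀ f g h a → f * (g - h * a) ≡ f * g - f * h * a
  pointwise = solve-∀ ℚ-ring

⟨constant,-⟩ : ∀ {n} (y b : Fin n → ℚ) → (∀ i j → y i ≡ y j) → ∑[ i < n ] b i ≡ 0ℚ → ⟨ y , b ⟩ ≡ 0ℚ
⟨constant,-⟩ {zero}  y b y-const ∑b≡0 = refl
⟨constant,-⟩ {suc n} y b y-const ∑b≡0 = begin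
  ∑[ i < suc n ] (y i * b i)       ≡⟨ sum-cong-≗ (λ i → cong (_* b i) (y-const i zero)) ⟩
  ∑[ i < suc n ] (y zero * b i)    ≡⟨ *-distribˡ-sum (y zero) b ⟨
  y zero * ∑[ i < suc n ] b i      ≡⟨ cong (y zero *_) ∑b≡0 ⟩
  y zero * 0ℚ                      ≡⟨ ℚ.*-zeroʳ (y zero) ⟩
  0ℚ                               ∎
  where open ≡-Reasoning

∑∑-squared-differences : ∀ n (z : Fin n → ℚ) → ∑[ i < n ] z i ≡ 0ℚ →
  ∑[ i < n ] ∑[ j < n ] ((z i - z j) * (z i - z j)) ≡ fromℕ n * (⟨ z , z ⟩ + ⟨ z , z ⟩)
∑∑-squared-differences n z ∑z≡0 = begin
  ∑[ i < n ] ∑[ j < n ] ((z i - z j) * (z i - z j))  ≡⟨ sum-cong-≗ row ⟩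
  ∑[ i < n ] (z i * z i * N + q)                     ≡⟨ ∑-distrib-+ (λ i → z i * z i * N) (λ _ → q) ⟩
  ∑[ i < n ] (z i * z i * N) + ∑[ i < n ] q          ≡⟨ cong₂ _+_ (*-distribʳ-sum N (λ i → z i * z i)) (sym (∑-const n q)) ⟨
  q * N + q * N                                      ≡⟨ double q N ⟩
  N * (q + q)                                        ∎
  where
  open ≡-Reasoning
  N q : ℚ
  N = fromℕ n
  q = ⟨ z , z ⟩
  double : ∀ a b → a * b + a * b ≡ b * (a + a)
  double = solve-∀ ℚ-ring
  expand : ∀ a b → (a - b) * (a - b) ≡ 1ℚ * (a * a) - (a + a) * b + b * b
  expand = solve-∀ ℚ-ring
  simplify : ∀ a b c → 1ℚ * a - b * 0ℚ + c ≡ a + c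
  simplify = solve-∀ ℚ-ring
  row : ∀ i → ∑[ j < n ] ((z i - z j) * (z i - z j)) ≡ z i * z i * N + q
  row i = begin
    ∑[ j < n ] ((z i - z j) * (z i - z j))                         ≡⟨ sum-cong-≗ (λ j → expand (z i) (z j)) ⟩
    ∑[ j < n ] (1ℚ * (z i * z i) - (z i + z i) * z j + z j * z j)  ≡⟨ ∑-linear n 1ℚ (z i + z i) (λ _ → z i * z i) z (λ j → z j * z j) ⟩
    1ℚ * ∑[ j < n ] (z i * z i) - (z i + z i) * ∑[ j < n ] z j + q
      ≡⟨ cong₂ (λ s t → 1ℚ * s - (z i + z i) * t + q) (∑-const n (z i * z i)) ∑z≡0 ⟩
    1ℚ * (z i * z i * N) - (z i + z i) * 0ℚ + q                    ≡⟨ simplify (z i * z i * N) (z i + z i) q ⟩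
    z i * z i * N + q                                              ∎

Matrix : ℕ → ℕ → Set
Matrix m n = Fin m → Fin n → ℚ

column : ∀ {m n} → Matrix m n → Fin n → Fin m → ℚ
column A j i = A i j

⟨-,-⟩-transpose : ∀ {m n} (A : Matrix m n) y x →
                  ⟨ y , (λ i → ⟨ A i , x ⟩) ⟩ ≡ ⟨ (λ j → ⟨ y , column A j ⟩) , x ⟩
⟨-,-⟩-transpose {m} {n} A y x = begin
  ∑[ i < m ] (y i * ∑[ j < n ] (A i j * x j))    ≡⟨ sum-cong-≗ (λ i → *-distribˡ-sum (y i) (λ j → A i j * x j)) ⟩
  ∑[ i < m ] ∑[ j < n ] (y i * (A i j * x j))    ≡⟨ ∑-comm (λ i j → y i * (A i j * x j)) ⟩
  ∑[ j < n ] ∑[ i < m ] (y i * (A i j * x j))    ≡⟨ sum-cong-≗ (λ j → sum-cong-≗ (λ i → ℚ.*-assoc (y i) (A i j) (x j))) ⟨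
  ∑[ j < n ] ∑[ i < m ] (y i * A i j * x j)      ≡⟨ sum-cong-≗ (λ j → *-distribʳ-sum (x j) (λ i → y i * A i j)) ⟨
  ∑[ j < n ] (∑[ i < m ] (y i * A i j) * x j)    ∎
  where open ≡-Reasoning

Solution : ∀ {m n} → Matrix m n → (Fin m → ℚ) → (Fin n → ℚ) → Set
Solution A b x = ∀ i → ⟨ A i , x ⟩ ≡ b i

Obstruction : ∀ {m n} → Matrix m n → (Fin m → ℚ) → (Fin m → ℚ) → Set
Obstruction A b y = (∀ j → ⟨ y , column A j ⟩ ≡ 0ℚ) × ⟨ y , b ⟩ ≢ 0ℚ

Alternative : ∀ {m n} → Matrix m n → (Fin m → ℚ) → Set
Alternative A b = ∃ (Solution A b) ⊎ ∃ (Obstruction A b)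

module _ {m n} (A : Matrix m (suc n)) (b : Fin m → ℚ) where

  dropColumn : Matrix m n
  dropColumn i j = A i (suc j)

  module _ (A₀≡0 : ∀ i → A i zero ≡ 0ℚ) where

    zeroColumn-solution : ∀ x → Solution dropColumn b x → Solution A b (0ℚ ∷ x)
    zeroColumn-solution x sol i = begin
      A i zero * 0ℚ + ⟨ dropColumn i , x ⟩  ≡⟨ cong (_+ ⟨ dropColumn i , x ⟩) (ℚ.*-zeroʳ (A i zero)) ⟩
      0ℚ + ⟨ dropColumn i , x ⟩             ≡⟨ ℚ.+-identityˡ _ ⟩
      ⟨ dropColumn i , x ⟩                  ≡⟨ sol i ⟩
      b i                                   ∎
      where open ≡-Reasoning

    zeroColumn-obstruction : ∀ y → Obstruction dropColumn b y → Obstruction A b y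
    zeroColumn-obstruction y (y⊥A′ , y·b≢0) = y⊥A , y·b≢0
      where
      y⊥A : ∀ j → ⟨ y , column A j ⟩ ≡ 0ℚ
      y⊥A zero    = trans (sum-cong-≗ (λ i → cong (y i *_) (A₀≡0 i))) (⟨-,0⟩ y)
      y⊥A (suc j) = y⊥A′ j

    zeroColumn-alternative : Alternative dropColumn b → Alternative A b
    zeroColumn-alternative (inj₁ (x , sol)) = inj₁ (0ℚ ∷ x , zeroColumn-solution x sol)
    zeroColumn-alternative (inj₂ (y , obs)) = inj₂ (y , zeroColumn-obstruction y obs)

  module Pivot (p : Fin m) (Ap₀≢0 : A p zero ≢ 0ℚ) where

    private instance
      Ap₀-nonZero : NonZero (A p zero)
      Ap₀-nonZero = ≢-nonZero Ap₀≢0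

    c : Fin m → ℚ
    c i = A i zero * 1/ A p zero

    eliminate : (Fin m → ℚ) → Fin m → ℚ
    eliminate g i = g i - c i * g p

    reduced : Matrix m n
    reduced i j = eliminate (column A (suc j)) i

    eliminate-column₀ : ∀ i → eliminate (column A zero) i ≡ 0ℚ
    eliminate-column₀ i = begin
      A i zero - A i zero * 1/ A p zero * A p zero    ≡⟨ cong (_-_ (A i zero)) (ℚ.*-assoc (A i zero) _ _) ⟩
      A i zero - A i zero * (1/ A p zero * A p zero)  ≡⟨ cong (λ t → A i zero - A i zero * t) (ℚ.*-inverseˡ (A p zero)) ⟩
      A i zero - A i zero * 1ℚ                        ≡⟨ cong (_-_ (A i zero)) (ℚ.*-identityʳ (A i zero)) ⟩
      A i zero - A i zero                             ≡⟨ ℚ.+-inverseʳ (A i zero) ⟩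
      0ℚ                                              ∎
      where open ≡-Reasoning

    back-substitute : (Fin n → ℚ) → Fin (suc n) → ℚ
    back-substitute x = (b p - ⟨ dropColumn p , x ⟩) * 1/ A p zero ∷ x

    solution-lift : ∀ x → Solution reduced (eliminate b) x → Solution A b (back-substitute x)
    solution-lift x sol i = begin
      A i zero * ((b p - Sₚ) * 1/ A p zero) + Sᵢ  ≡⟨ regroup (A i zero) (1/ A p zero) (b p) Sₚ Sᵢ ⟩
      c i * b p + (Sᵢ - c i * Sₚ)                 ≡⟨ cong (c i * b p +_) reduced-row ⟩
      c i * b p + (b i - c i * b p)               ≡⟨ cancel (c i * b p) (b i) ⟩
      b i                                         ∎
      where
      open ≡-Reasoning
      Sᵢ Sₚ : ℚ
      Sᵢ = ⟨ dropColumn i , x ⟩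
      Sₚ = ⟨ dropColumn p , x ⟩
      reduced-row : Sᵢ - c i * Sₚ ≡ b i - c i * b p
      reduced-row = trans (sym (⟨-,-⟩-sub-scaledˡ (dropColumn i) (dropColumn p) x (c i))) (sol i)
      regroup : ∀ a a⁻¹ β s t → a * ((β - s) * a⁻¹) + t ≡ a * a⁻¹ * β + (t - a * a⁻¹ * s)
      regroup = solve-∀ ℚ-ring
      cancel : ∀ s t → s + (t - s) ≡ t
      cancel = solve-∀ ℚ-ring

    lift : (Fin m → ℚ) → Fin m → ℚ
    lift y i = y i - ⟨ y , c ⟩ * δ p i

    ⟨lift,-⟩ : ∀ y g → ⟨ lift y , g ⟩ ≡ ⟨ y , eliminate g ⟩
    ⟨lift,-⟩ y g = begin
      ⟨ lift y , g ⟩                     ≡⟨ ⟨-,-⟩-sub-scaledˡ y (δ p) g ⟨ y , c ⟩ ⟩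
      ⟨ y , g ⟩ - ⟨ y , c ⟩ * ⟨ δ p , g ⟩  ≡⟨ cong (λ t → ⟨ y , g ⟩ - ⟨ y , c ⟩ * t) (⟨δ,-⟩ p g) ⟩
      ⟨ y , g ⟩ - ⟨ y , c ⟩ * g p          ≡⟨ ⟨-,-⟩-sub-scaledʳ y g c (g p) ⟨
      ⟨ y , eliminate g ⟩                ∎
      where open ≡-Reasoning

    obstruction-lift : ∀ y → Obstruction reduced (eliminate b) y → Obstruction A b (lift y)
    obstruction-lift y (y⊥A′ , y·b′≢0) = lift⊥A , λ e → y·b′≢0 (trans (sym (⟨lift,-⟩ y b)) e)
      where
      lift⊥A : ∀ j → ⟨ lift y , column A j ⟩ ≡ 0ℚ
      lift⊥A zero    = trans (⟨lift,-⟩ y (column A zero))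
                         (trans (sum-cong-≗ (λ i → cong (y i *_) (eliminate-column₀ i))) (⟨-,0⟩ y))
      lift⊥A (suc j) = trans (⟨lift,-⟩ y (column A (suc j))) (y⊥A′ j)

    pivot-alternative : Alternative reduced (eliminate b) → Alternative A b
    pivot-alternative (inj₁ (x , sol)) = inj₁ (back-substitute x , solution-lift x sol)
    pivot-alternative (inj₂ (y , obs)) = inj₂ (lift y , obstruction-lift y obs)

fredholm-alternative : ∀ m n (A : Matrix m n) b → Alternative A b
fredholm-alternative m zero A b with all? (λ i → b i ℚ.≟ 0ℚ)
... | yes b≡0 = inj₁ ((λ ()) , λ i → sym (b≡0 i))
... | no  b≢0 with ¬∀⟶∃¬ m _ (λ i → b i ℚ.≟ 0ℚ) b≢0
...   | p , bₚ≢0 = inj₂ (δ p , (λ ()) , λ e → bₚ≢0 (trans (sym (⟨δ,-⟩ p b)) e))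
fredholm-alternative m (suc n) A b with all? (λ i → A i zero ℚ.≟ 0ℚ)
... | yes A₀≡0 = zeroColumn-alternative A b A₀≡0 (fredholm-alternative m n (dropColumn A b) b)
... | no  A₀≢0 with ¬∀⟶∃¬ m _ (λ i → A i zero ℚ.≟ 0ℚ) A₀≢0
...   | p , Aₚ₀≢0 = pivot-alternative (fredholm-alternative m n reduced (eliminate b))
  where open Pivot A b p Aₚ₀≢0

δ-self : ∀ {n} (u : Fin n) → δ u u ≡ 1ℚ
δ-self u with u ≟ u
... | yes _   = refl
... | no  u≢u = ⊥-elim (u≢u refl)

δ-other : ∀ {n} {u i : Fin n} → i ≢ u → δ u i ≡ 0ℚ
δ-other {u = u} {i} i≢u with i ≟ u
... | yes i≡u = ⊥-elim (i≢u i≡u)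
... | no  _   = refl

⟨-,unitCurrent⟩ : ∀ {n} (f : Fin n → ℚ) u v → ⟨ f , unitCurrent u v ⟩ ≡ f u - f v
⟨-,unitCurrent⟩ {n} f u v = begin
  ∑[ i < n ] (f i * (δ u i - δ v i))        ≡⟨ sum-cong-≗ (λ i → x[y-z]≈xy-xz (f i) (δ u i) (δ v i)) ⟩
  ∑[ i < n ] (f i * δ u i - f i * δ v i)    ≡⟨ ∑-distrib-- n _ _ ⟩
  ⟨ f , δ u ⟩ - ⟨ f , δ v ⟩                 ≡⟨ cong₂ _-_ (⟨-,δ⟩ f u) (⟨-,δ⟩ f v) ⟩
  f u - f v                                 ∎
  where open ≡-Reasoning

∑-unitCurrent : ∀ {n} (u v : Fin n) → ∑[ i < n ] unitCurrent u v i ≡ 0ℚ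
∑-unitCurrent {n} u v = begin
  ∑[ i < n ] unitCurrent u v i                   ≡⟨ sum-cong-≗ (λ i → ℚ.*-identityˡ (unitCurrent u v i)) ⟨
  ⟨ (λ _ → 1ℚ) , unitCurrent u v ⟩               ≡⟨ ⟨-,unitCurrent⟩ (λ _ → 1ℚ) u v ⟩
  1ℚ - 1ℚ                                       ≡⟨ ℚ.+-inverseʳ 1ℚ ⟩
  0ℚ                                            ∎
  where open ≡-Reasoning

module _ {n} {u v : Fin n} (u≢v : u ≢ v) where

  private
    e : Fin n → ℚ
    e = unitCurrent u v
    v≢u : v ≢ u
    v≢u v≡u = u≢v (sym v≡u)

  unitCurrent-source : e u ≡ 1ℚ - 0ℚ
  unitCurrent-source = cong₂ _-_ (δ-self u) (δ-other u≢v)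

  unitCurrent-sink : e v ≡ 0ℚ - 1ℚ
  unitCurrent-sink = cong₂ _-_ (δ-other v≢u) (δ-self v)

  unitCurrent-elsewhere : ∀ {w} → w ≢ u → w ≢ v → e w ≡ 0ℚ - 0ℚ
  unitCurrent-elsewhere w≢u w≢v = cong₂ _-_ (δ-other w≢u) (δ-other w≢v)

  unitCurrent-drop : e u - e v ≡ 2ℚ
  unitCurrent-drop = cong₂ _-_ unitCurrent-source unitCurrent-sink

  ⟨unitCurrent,unitCurrent⟩ : ⟨ e , e ⟩ ≡ 2ℚ
  ⟨unitCurrent,unitCurrent⟩ = trans (⟨-,unitCurrent⟩ e u v) unitCurrent-drop

  unitCurrent-source-gap : ∀ {w} → w ≢ u → e u ≢ e w
  unitCurrent-source-gap {w} w≢u eu≡ew = by-cases (w ≟ v)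
    where
    1≢-1 : 1ℚ - 0ℚ ≢ 0ℚ - 1ℚ
    1≢-1 ()
    1≢0 : 1ℚ - 0ℚ ≢ 0ℚ - 0ℚ
    1≢0 ()
    by-cases : Dec (w ≡ v) → ⊥
    by-cases (yes w≡v) = 1≢-1 (trans (sym unitCurrent-source) (trans eu≡ew (trans (cong e w≡v) unitCurrent-sink)))
    by-cases (no  w≢v) = 1≢0 (trans (sym unitCurrent-source) (trans eu≡ew (unitCurrent-elsewhere w≢u w≢v)))

  unitCurrent-sink-gap : ∀ {w} → w ≢ v → e v ≢ e w
  unitCurrent-sink-gap {w} w≢v ev≡ew = by-cases (w ≟ u)
    where
    -1≢1 : 0ℚ - 1ℚ ≢ 1ℚ - 0ℚ
    -1≢1 ()
    -1≢0 : 0ℚ - 1ℚ ≢ 0ℚ - 0ℚ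
    -1≢0 ()
    by-cases : Dec (w ≡ u) → ⊥
    by-cases (yes w≡u) = -1≢1 (trans (sym unitCurrent-sink) (trans ev≡ew (trans (cong e w≡u) unitCurrent-source)))
    by-cases (no  w≢u) = -1≢0 (trans (sym unitCurrent-sink) (trans ev≡ew (unitCurrent-elsewhere w≢u w≢v)))

Adj-sym : ∀ {n} (G : Graph n) {i j} → Adj G i j → Adj G j i
Adj-sym G {i} {j} i~j = trans (symm G j i) i~j

module _ {n} {G : Graph n} where

  Reach-trans : ∀ {i j k} → Reach G i j → Reach G j k → Reach G i k
  Reach-trans here          j⇝k = j⇝k
  Reach-trans (step i~l l⇝j) j⇝k = step i~l (Reach-trans l⇝j j⇝k)

  Reach-sym : ∀ {i j} → Reach G i j → Reach G j i
  Reach-sym here           = here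
  Reach-sym (step i~l l⇝j) = Reach-trans (Reach-sym l⇝j) (step (Adj-sym G i~l) here)

removeEdge-adj : ∀ {n} (G : Graph n) a b {i j} → Adj G i j →
                 Adj (removeEdge G a b) i j ⊎ ((i ≡ a × j ≡ b) ⊎ (i ≡ b × j ≡ a))
removeEdge-adj G a b {i} {j} i~j with i ≟ a | j ≟ b | j ≟ a | i ≟ b
... | yes i≡a | yes j≡b | _       | _       = inj₂ (inj₁ (i≡a , j≡b))
... | _       | _       | yes j≡a | yes i≡b = inj₂ (inj₂ (i≡b , j≡a))
... | no _    | _       | no _    | _       = inj₁ i~j
... | no _    | _       | yes _   | no _    = inj₁ i~j
... | yes _   | no _    | no _    | _       = inj₁ i~j
... | yes _   | no _    | yes _   | no _    = inj₁ i~j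

removeEdge-keeps : ∀ {n} (G : Graph n) {a b i j} → i ≢ a → i ≢ b → Adj G i j → Adj (removeEdge G a b) i j
removeEdge-keeps G {a} {b} i≢a i≢b i~j with removeEdge-adj G a b i~j
... | inj₁ kept              = kept
... | inj₂ (inj₁ (i≡a , _)) = ⊥-elim (i≢a i≡a)
... | inj₂ (inj₂ (i≡b , _)) = ⊥-elim (i≢b i≡b)

Dominating : ∀ {n} → Graph n → Fin n → Set
Dominating G u = ∀ w → w ≡ u ⊎ Adj G u w

dominating? : ∀ {n} (G : Graph n) u → Dec (Dominating G u)
dominating? G u = all? (λ w → (w ≟ u) ⊎-dec (adj G u w Bool.≟ true))

-- Removing an edge {a, b} = {u, w} leaves the detour u ~ m ~ w, where m is v or, if w = v, the third vertex t.
module _ {n} (G : Graph n) {u v t : Fin n} (u≢v : u ≢ v) (t≢u : t ≢ u) (t≢v : t ≢ v)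
         (u-dom : Dominating G u) (v-dom : Dominating G v) where

  private
    adjacentTo : ∀ {x} → Dominating G x → ∀ {w} → w ≢ x → Adj G x w
    adjacentTo x-dom {w} w≢x with x-dom w
    ... | inj₁ w≡x = ⊥-elim (w≢x w≡x)
    ... | inj₂ x~w = x~w

    detour : ∀ w → w ≢ u → ∃ λ m → m ≢ u × m ≢ w × Adj G m u × Adj G m w
    detour w w≢u with w ≟ v
    ... | yes refl = t , t≢u , t≢v , Adj-sym G (adjacentTo u-dom t≢u) , Adj-sym G (adjacentTo v-dom t≢v)
    ... | no  w≢v  = v , v≢u , (λ v≡w → w≢v (sym v≡w)) , Adj-sym G (adjacentTo u-dom v≢u) , adjacentTo v-dom w≢v
      where
      v≢u : v ≢ u
      v≢u v≡u = u≢v (sym v≡u)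

    avoids : ∀ {m w a b : Fin n} → m ≢ u → m ≢ w → (u ≡ a × w ≡ b) ⊎ (u ≡ b × w ≡ a) → m ≢ a × m ≢ b
    avoids m≢u m≢w (inj₁ (refl , refl)) = m≢u , m≢w
    avoids m≢u m≢w (inj₂ (refl , refl)) = m≢w , m≢u

  dominatingPair⇒removeEdge-connected : ∀ a b → Connected (removeEdge G a b)
  dominatingPair⇒removeEdge-connected a b x y = Reach-trans (Reach-sym (from-u x)) (from-u y)
    where
    from-u : ∀ w → Reach (removeEdge G a b) u w
    from-u w with w ≟ u
    ... | yes refl = here
    ... | no  w≢u with removeEdge-adj G a b (adjacentTo u-dom w≢u)
    ...   | inj₁ u~w = step u~w here
    ...   | inj₂ uw≡ab with detour w w≢u
    ...     | m , m≢u , m≢w , m~u , m~w with avoids m≢u m≢w uw≡ab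
    ...       | m≢a , m≢b = step (Adj-sym (removeEdge G a b) (removeEdge-keeps G m≢a m≢b m~u))
                                 (step (removeEdge-keeps G m≢a m≢b m~w) here)

NonEdgeAt : ∀ {n} → Graph n → Fin n → Set
NonEdgeAt G x = ∃ λ w → w ≢ x × adj G x w ≡ false

¬dominating⇒nonEdgeAt : ∀ {n} (G : Graph n) x → ¬ Dominating G x → NonEdgeAt G x
¬dominating⇒nonEdgeAt {n} G x ¬dom with ¬∀⟶∃¬ n _ (λ w → (w ≟ x) ⊎-dec (adj G x w Bool.≟ true)) ¬dom
... | w , ¬[w≡x⊎x~w] = w , (λ w≡x → ¬[w≡x⊎x~w] (inj₁ w≡x)) , ¬-not (λ x~w → ¬[w≡x⊎x~w] (inj₂ x~w))

cutEdge⇒nonEdgeAt : ∀ {n} (G : Graph n) {u v t} → u ≢ v → t ≢ u → t ≢ v →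
                    HasCutEdge G → NonEdgeAt G u ⊎ NonEdgeAt G v
cutEdge⇒nonEdgeAt G {u} {v} u≢v t≢u t≢v (a , b , _ , disconnected) with dominating? G u | dominating? G v
... | yes u-dom | yes v-dom = ⊥-elim (disconnected (dominatingPair⇒removeEdge-connected G u≢v t≢u t≢v u-dom v-dom a b))
... | no ¬u-dom | _         = inj₁ (¬dominating⇒nonEdgeAt G u ¬u-dom)
... | yes _     | no ¬v-dom = inj₂ (¬dominating⇒nonEdgeAt G v ¬v-dom)

third-vertex : ∀ {k} (u v : Fin (suc (suc (suc k)))) → ∃ λ t → t ≢ u × t ≢ v
third-vertex zero          zero          = suc zero       , (λ ()) , (λ ())
third-vertex zero          (suc zero)    = suc (suc zero) , (λ ()) , (λ ())
third-vertex zero          (suc (suc _)) = suc zero       , (λ ()) , (λ ())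
third-vertex (suc zero)    zero          = suc (suc zero) , (λ ()) , (λ ())
third-vertex (suc zero)    (suc _)       = zero           , (λ ()) , (λ ())
third-vertex (suc (suc _)) zero          = suc zero       , (λ ()) , (λ ())
third-vertex (suc (suc _)) (suc _)       = zero           , (λ ()) , (λ ())

cutEdge⇒separating-nonEdge : ∀ {k} (G : Graph (suc (suc (suc k)))) {u v} → u ≢ v → HasCutEdge G →
                             ∃ λ i → ∃ λ j → adj G i j ≡ false × unitCurrent u v i ≢ unitCurrent u v j
cutEdge⇒separating-nonEdge G {u} {v} u≢v cut with third-vertex u v
... | t , t≢u , t≢v with cutEdge⇒nonEdgeAt G u≢v t≢u t≢v cut
...   | inj₁ (w , w≢u , u≁w) = u , w , u≁w , unitCurrent-source-gap u≢v w≢u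
...   | inj₂ (w , w≢v , v≁w) = v , w , v≁w , unitCurrent-sink-gap u≢v w≢v

module _ {n} (G : Graph n) where

  weight : Fin n → Fin n → ℚ
  weight i j = if adj G i j then 1ℚ else 0ℚ

  weight-sym : ∀ i j → weight i j ≡ weight j i
  weight-sym i j = cong (if_then 1ℚ else 0ℚ) (symm G i j)

  weight-edge : ∀ {i j} → Adj G i j → weight i j ≡ 1ℚ
  weight-edge = cong (if_then 1ℚ else 0ℚ)

  weight-nonEdge : ∀ {i j} → adj G i j ≡ false → weight i j ≡ 0ℚ
  weight-nonEdge = cong (if_then 1ℚ else 0ℚ)

  laplacian-weighted : ∀ x i → laplacian G x i ≡ ∑[ j < n ] (weight i j * (x i - x j))
  laplacian-weighted x i = trans (sumFin≡∑ n _) (sum-cong-≗ pointwise)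
    where
    pointwise : ∀ j → (if adj G i j then x i - x j else 0ℚ) ≡ weight i j * (x i - x j)
    pointwise j with adj G i j
    ... | true  = sym (ℚ.*-identityˡ (x i - x j))
    ... | false = sym (ℚ.*-zeroˡ (x i - x j))

  degree : Fin n → ℚ
  degree i = ∑[ j < n ] weight i j

  laplacianMatrix : Matrix n n
  laplacianMatrix i j = degree i * δ i j - weight i j

  laplacianMatrix-row : ∀ x i → ⟨ laplacianMatrix i , x ⟩ ≡ laplacian G x i
  laplacianMatrix-row x i = begin
    ∑[ j < n ] ((degree i * δ i j - weight i j) * x j)     ≡⟨ sum-cong-≗ (λ j → matrix-entry (degree i) (δ i j) (weight i j) (x j)) ⟩
    ∑[ j < n ] (degree i * (δ i j * x j) - weight i j * x j) ≡⟨ ∑-distrib-- n _ _ ⟩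
    ∑[ j < n ] (degree i * (δ i j * x j)) - Wx               ≡⟨ cong (_- Wx) (*-distribˡ-sum (degree i) (λ j → δ i j * x j)) ⟨
    degree i * ⟨ δ i , x ⟩ - Wx                            ≡⟨ cong (λ t → degree i * t - Wx) (⟨δ,-⟩ i x) ⟩
    degree i * x i - Wx                                    ≡⟨ cong (_- Wx) (trans (ℚ.*-comm (degree i) (x i)) (*-distribˡ-sum (x i) (weight i))) ⟩
    ∑[ j < n ] (x i * weight i j) - Wx                     ≡⟨ ∑-distrib-- n _ _ ⟨
    ∑[ j < n ] (x i * weight i j - weight i j * x j)       ≡⟨ sum-cong-≗ (λ j → laplacian-entry (x i) (weight i j) (x j)) ⟩
    ∑[ j < n ] (weight i j * (x i - x j))                  ≡⟨ laplacian-weighted x i ⟨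
    laplacian G x i                                        ∎
    where
    open ≡-Reasoning
    Wx : ℚ
    Wx = ∑[ j < n ] (weight i j * x j)
    matrix-entry : ∀ d e w y → (d * e - w) * y ≡ d * (e * y) - w * y
    matrix-entry = solve-∀ ℚ-ring
    laplacian-entry : ∀ y w y′ → y * w - w * y′ ≡ w * (y - y′)
    laplacian-entry = solve-∀ ℚ-ring

  energy : (Fin n → ℚ) → (Fin n → ℚ) → ℚ
  energy z x = ∑[ i < n ] ∑[ j < n ] (weight i j * ((z i - z j) * (x i - x j)))

  energy-⟨-,L-⟩ : ∀ z x → energy z x ≡ ⟨ z , laplacian G x ⟩ + ⟨ z , laplacian G x ⟩
  energy-⟨-,L-⟩ z x = begin
    energy z x                                                      ≡⟨ sum-cong-≗ (λ i → sum-cong-≗ (split i)) ⟩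
    ∑[ i < n ] ∑[ j < n ] (T i j + T j i)                           ≡⟨ sum-cong-≗ (λ i → ∑-distrib-+ (T i) (λ j → T j i)) ⟩
    ∑[ i < n ] (∑[ j < n ] T i j + ∑[ j < n ] T j i)                ≡⟨ ∑-distrib-+ (λ i → ∑[ j < n ] T i j) (λ i → ∑[ j < n ] T j i) ⟩
    ∑[ i < n ] ∑[ j < n ] T i j + ∑[ i < n ] ∑[ j < n ] T j i       ≡⟨ cong (∑[ i < n ] ∑[ j < n ] T i j +_) (∑-comm T) ⟨
    ∑[ i < n ] ∑[ j < n ] T i j + ∑[ i < n ] ∑[ j < n ] T i j       ≡⟨ cong (λ s → s + s) (sum-cong-≗ row) ⟩
    ⟨ z , laplacian G x ⟩ + ⟨ z , laplacian G x ⟩                   ∎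
    where
    open ≡-Reasoning
    T : Fin n → Fin n → ℚ
    T i j = weight i j * (z i * (x i - x j))
    halves : ∀ w p q r s → w * ((p - q) * (r - s)) ≡ w * (p * (r - s)) + w * (q * (s - r))
    halves = solve-∀ ℚ-ring
    split : ∀ i j → weight i j * ((z i - z j) * (x i - x j)) ≡ T i j + T j i
    split i j = trans (halves (weight i j) (z i) (z j) (x i) (x j))
                      (cong (λ w → T i j + w * (z j * (x j - x i))) (weight-sym i j))
    rearrange : ∀ w p q → w * (p * q) ≡ p * (w * q)
    rearrange = solve-∀ ℚ-ring
    row : ∀ i → ∑[ j < n ] T i j ≡ z i * laplacian G x i
    row i = begin
      ∑[ j < n ] T i j                            ≡⟨ sum-cong-≗ (λ j → rearrange (weight i j) (z i) (x i - x j)) ⟩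
      ∑[ j < n ] (z i * (weight i j * (x i - x j))) ≡⟨ *-distribˡ-sum (z i) (λ j → weight i j * (x i - x j)) ⟨
      z i * ∑[ j < n ] (weight i j * (x i - x j))   ≡⟨ cong (z i *_) (laplacian-weighted x i) ⟨
      z i * laplacian G x i                       ∎

  weighted-square-nonNeg : ∀ i j p → 0ℚ ≤ℚ weight i j * (p * p)
  weighted-square-nonNeg i j p with adj G i j
  ... | true  = subst (0ℚ ≤ℚ_) (sym (ℚ.*-identityˡ (p * p))) (square-nonNeg p)
  ... | false = ℚ.≤-reflexive (sym (ℚ.*-zeroˡ (p * p)))

  energy-nonNeg : ∀ z → 0ℚ ≤ℚ energy z z
  energy-nonNeg z = ∑-nonNeg n (λ i → ∑-nonNeg n (λ j → weighted-square-nonNeg i j (z i - z j)))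

  energy≡0⇒edge-constant : ∀ z → energy z z ≡ 0ℚ → ∀ {i j} → Adj G i j → z i ≡ z j
  energy≡0⇒edge-constant z energy≡0 {i} {j} i~j = x∙y⁻¹≈ε⇒x≈y (z i) (z j) (square≡0⇒≡0 square≡0)
    where
    term≡0 : weight i j * ((z i - z j) * (z i - z j)) ≡ 0ℚ
    term≡0 = ∑-nonNeg-≡0 n (λ k → weighted-square-nonNeg i k (z i - z k))
               (∑-nonNeg-≡0 n (λ k → ∑-nonNeg n (λ l → weighted-square-nonNeg k l (z k - z l))) energy≡0 i) j
    square≡0 : (z i - z j) * (z i - z j) ≡ 0ℚ
    square≡0 = trans (sym (ℚ.*-identityˡ _)) (trans (cong (_* _) (sym (weight-edge i~j))) term≡0)

  edge-constant⇒Reach-constant : ∀ (z : Fin n → ℚ) → (∀ {i j} → Adj G i j → z i ≡ z j) →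
                                  ∀ {i j} → Reach G i j → z i ≡ z j
  edge-constant⇒Reach-constant z edge-const here           = refl
  edge-constant⇒Reach-constant z edge-const (step i~k k⇝j) =
    trans (edge-const i~k) (edge-constant⇒Reach-constant z edge-const k⇝j)

  energy<complete : ∀ z {i j} → adj G i j ≡ false → z i ≢ z j →
                    energy z z < ∑[ i < n ] ∑[ j < n ] ((z i - z j) * (z i - z j))
  energy<complete z {i} {j} i≁j zᵢ≢zⱼ =
    ∑-mono-< n (λ k → ∑-mono-≤ n (term≤ k)) i (∑-mono-< n (term≤ i) j term<)
    where
    sq : Fin n → Fin n → ℚ
    sq k l = (z k - z l) * (z k - z l)
    term≤ : ∀ k l → weight k l * sq k l ≤ℚ sq k l
    term≤ k l with adj G k l
    ... | true  = ℚ.≤-reflexive (ℚ.*-identityˡ (sq k l))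
    ... | false = subst (_≤ℚ sq k l) (sym (ℚ.*-zeroˡ (sq k l))) (square-nonNeg (z k - z l))
    term< : weight i j * sq i j < sq i j
    term< = subst (_< sq i j) (sym (trans (cong (_* sq i j) (weight-nonEdge i≁j)) (ℚ.*-zeroˡ (sq i j))))
              (square-pos (λ d≡0 → zᵢ≢zⱼ (x∙y⁻¹≈ε⇒x≈y (z i) (z j) d≡0)))

  energy-expand : ∀ c x z → energy (λ i → c * x i - z i) (λ i → c * x i - z i)
                            ≡ c * c * energy x x - (c + c) * energy z x + energy z z
  energy-expand c x z = begin
    energy y y                                                      ≡⟨ sum-cong-≗ (λ i → trans (sum-cong-≗ (term i)) (∑-linear n (c * c) (c + c) _ _ _)) ⟩
    ∑[ i < n ] (c * c * ∑[ j < n ] E x x i j - (c + c) * ∑[ j < n ] E z x i j + ∑[ j < n ] E z z i j)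
                                                                    ≡⟨ ∑-linear n (c * c) (c + c) _ _ _ ⟩
    c * c * energy x x - (c + c) * energy z x + energy z z          ∎
    where
    open ≡-Reasoning
    y : Fin n → ℚ
    y i = c * x i - z i
    E : (Fin n → ℚ) → (Fin n → ℚ) → Fin n → Fin n → ℚ
    E f g i j = weight i j * ((f i - f j) * (g i - g j))
    quadratic : ∀ w c p q s t → w * (((c * p - s) - (c * q - t)) * ((c * p - s) - (c * q - t)))
                              ≡ c * c * (w * ((p - q) * (p - q))) - (c + c) * (w * ((s - t) * (p - q))) + w * ((s - t) * (s - t))
    quadratic = solve-∀ ℚ-ring
    term : ∀ i j → E y y i j ≡ c * c * E x x i j - (c + c) * E z x i j + E z z i j
    term i j = quadratic (weight i j) c (x i) (x j) (z i) (z j)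

laplacian-solvable : ∀ {n} (G : Graph n) → Connected G → ∀ b → ∑[ i < n ] b i ≡ 0ℚ →
                     ∃ λ x → ∀ i → laplacian G x i ≡ b i
laplacian-solvable {n} G connected b ∑b≡0 with fredholm-alternative n n (laplacianMatrix G) b
... | inj₁ (x , sol)            = x , λ i → trans (sym (laplacianMatrix-row G x i)) (sol i)
... | inj₂ (y , y⊥L , y·b≢0) = ⊥-elim (y·b≢0 (⟨constant,-⟩ y b y-constant ∑b≡0))
  where
  ⟨y,Ly⟩≡0 : ⟨ y , laplacian G y ⟩ ≡ 0ℚ
  ⟨y,Ly⟩≡0 = begin
    ⟨ y , laplacian G y ⟩                                          ≡⟨ sum-cong-≗ (λ i → cong (y i *_) (laplacianMatrix-row G y i)) ⟨
    ⟨ y , (λ i → ⟨ laplacianMatrix G i , y ⟩) ⟩                     ≡⟨ ⟨-,-⟩-transpose (laplacianMatrix G) y y ⟩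
    ⟨ (λ j → ⟨ y , column (laplacianMatrix G) j ⟩) , y ⟩            ≡⟨ sum-cong-≗ (λ j → cong (_* y j) (y⊥L j)) ⟩
    ⟨ (λ _ → 0ℚ) , y ⟩                                            ≡⟨ trans (⟨-,-⟩-comm _ y) (⟨-,0⟩ y) ⟩
    0ℚ                                                            ∎
    where open ≡-Reasoning
  y-constant : ∀ i j → y i ≡ y j
  y-constant i j = edge-constant⇒Reach-constant G y
                     (energy≡0⇒edge-constant G y (trans (energy-⟨-,L-⟩ G y y) (cong (λ s → s + s) ⟨y,Ly⟩≡0)))
                     (connected i j)

resistance-bound : ∀ {n} (G : Graph n) {u v} → u ≢ v → ∀ x → (∀ i → laplacian G x i ≡ unitCurrent u v i) →
                   ∀ {i j} → adj G i j ≡ false → unitCurrent u v i ≢ unitCurrent u v j →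
                   2ℚ < fromℕ n * (x u - x v)
resistance-bound {n} G {u} {v} u≢v x Lx≡e i≁j eᵢ≢eⱼ =
  conclude (ℚ.nonNegative⁻¹ N) (subst (0ℚ ≤ℚ_) expansion (energy-nonNeg G (λ i → N * x i - e i)))
           (subst (energy G e e <_) complete-value (energy<complete G e i≁j eᵢ≢eⱼ))
  where
  N r : ℚ
  N = fromℕ n
  r = x u - x v
  e : Fin n → ℚ
  e = unitCurrent u v
  ⟨-,Lx⟩ : ∀ z → ⟨ z , laplacian G x ⟩ ≡ z u - z v
  ⟨-,Lx⟩ z = trans (sum-cong-≗ (λ i → cong (z i *_) (Lx≡e i))) (⟨-,unitCurrent⟩ z u v)
  expansion : energy G (λ i → N * x i - e i) (λ i → N * x i - e i) ≡ N * N * (r + r) - (N + N) * (2ℚ + 2ℚ) + energy G e e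
  expansion = trans (energy-expand G N x e)
    (cong₂ (λ s t → N * N * s - (N + N) * t + energy G e e)
      (trans (energy-⟨-,L-⟩ G x x) (cong (λ s → s + s) (⟨-,Lx⟩ x)))
      (trans (energy-⟨-,L-⟩ G e x) (cong (λ s → s + s) (trans (⟨-,Lx⟩ e) (unitCurrent-drop u≢v)))))
  complete-value : ∑[ i < n ] ∑[ j < n ] ((e i - e j) * (e i - e j)) ≡ N * (2ℚ + 2ℚ)
  complete-value = trans (∑∑-squared-differences n e (∑-unitCurrent u v))
                         (cong (λ s → N * (s + s)) (⟨unitCurrent,unitCurrent⟩ u≢v))
  factor : ∀ N r → N * N * (r + r) - (N + N) * (2ℚ + 2ℚ) + N * (2ℚ + 2ℚ) ≡ (N + N) * (N * r - 2ℚ)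
  factor = solve-∀ ℚ-ring
  cancel : ∀ a b → a - b + b ≡ a
  cancel = solve-∀ ℚ-ring
  conclude : 0ℚ ≤ℚ N → 0ℚ ≤ℚ N * N * (r + r) - (N + N) * (2ℚ + 2ℚ) + energy G e e →
             energy G e e < N * (2ℚ + 2ℚ) → 2ℚ < N * r
  conclude 0≤N 0≤D+q q<4N = subst₂ _<_ (ℚ.+-identityˡ 2ℚ) (cancel (N * r) 2ℚ) (ℚ.+-monoˡ-< 2ℚ 0<Nr-2)
    where
    0<[N+N][Nr-2] : 0ℚ < (N + N) * (N * r - 2ℚ)
    0<[N+N][Nr-2] = subst (0ℚ <_) (factor N r) (ℚ.≤-<-trans 0≤D+q (ℚ.+-monoʳ-< (N * N * (r + r) - (N + N) * (2ℚ + 2ℚ)) q<4N))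
    0<Nr-2 : 0ℚ < N * r - 2ℚ
    0<Nr-2 = ℚ.*-cancelˡ-<-nonNeg (N + N) {{nonNegative (ℚ.+-mono-≤ 0≤N 0≤N)}}
               (subst (_< (N + N) * (N * r - 2ℚ)) (sym (ℚ.*-zeroʳ (N + N))) 0<[N+N][Nr-2])

twoOver-inverse : ∀ n → fromℕ (suc n) * twoOver (suc n) ≡ 2ℚ
twoOver-inverse n = begin
  -- 2ℚ * 1/ N normalises to (ℤ.+ 2 ℤ.* ℤ.+ 1) / (1 ℕ.* suc n).
  N * twoOver (suc n)  ≡⟨ cong (N *_) (ℚ./-cong {p₁ = ℤ.+ 2} {p₂ = ℤ.+ 2} refl (sym (ℕ.*-identityˡ (suc n)))) ⟩
  N * (2ℚ * 1/ N)      ≡⟨ ℚ.*-comm N (2ℚ * 1/ N) ⟩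
  2ℚ * 1/ N * N        ≡⟨ ℚ.*-assoc 2ℚ (1/ N) N ⟩
  2ℚ * (1/ N * N)      ≡⟨ cong (2ℚ *_) (ℚ.*-inverseˡ N) ⟩
  2ℚ * 1ℚ              ≡⟨ ℚ.*-identityʳ 2ℚ ⟩
  2ℚ                   ∎
  where
  open ≡-Reasoning
  N : ℚ
  N = fromℕ (suc n)

twoOver<⇐ : ∀ k {r} → 2ℚ < fromℕ (suc k) * r → twoOver (suc k) < r
twoOver<⇐ k {r} 2<Nr =
  ℚ.*-cancelˡ-<-nonNeg (fromℕ (suc k)) (subst (_< fromℕ (suc k) * r) (sym (twoOver-inverse k)) 2<Nr)

mainTheorem12 : (n : ℕ) → 3 ≤ n → (G : Graph n) → Connected G → HasCutEdge G →
    (u v : Fin n) → u ≢ v →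
    Σ ℚ (λ r → IsEffRes G u v r)
    × ((r : ℚ) → IsEffRes G u v r → twoOver n < r)
mainTheorem12 (suc (suc (suc k))) (s≤s (s≤s (s≤s _))) G connected cut u v u≢v =
  let (x , Lx≡e) = laplacian-solvable G connected (unitCurrent u v) (∑-unitCurrent u v)
      (i , j , i≁j , eᵢ≢eⱼ) = cutEdge⇒separating-nonEdge G u≢v cut
  in (x u - x v , x , Lx≡e , refl) ,
     λ r (y , Ly≡e , r≡y) → subst (twoOver (suc (suc (suc k))) <_) (sym r≡y)
                              (twoOver<⇐ (suc (suc k)) (resistance-bound G u≢v y Ly≡e i≁j eᵢ≢eⱼ))
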